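{- Let $\mathbf A$ be a connexive Heyting algebra, let $\overline A=\{\neg\neg a:a\in A\}$, and define on $\overline A$ the operations $x\Cap y:=x\wedge y$ and $x\Cup y:=\neg\neg(x\vee y)$. Then $\overline{\mathbf A}=\langle\overline A,\Cap,\Cup,\rightarrow,0,1\rangle$ (with $\rightarrow$ the restriction of that of $\mathbf A$) is a connexive Boolean algebra, and the map $a\mapsto\neg\neg a$ from $A$ onto $\overline A$ is a surjective map preserving $\wedge$, $\rightarrow$, $0$ and $1$.
   Context: A connexive Heyting algebra is an algebra $\langle A,\wedge,\vee,\rightarrow,0,1\rangle$ whose $\{\wedge,\vee,0,1\}$-reduct is a bounded distributive lattice with lattice order $\le$, satisfying, with $\neg x:=x\rightarrow0$: (C1) $(x\rightarrow y)\rightarrow((y\rightarrow z)\rightarrow(x\rightarrow z))=1$; (C2) $(x\rightarrow y)\rightarrow\neg(x\rightarrow\neg y)=1$; (C3) $x\wedge(x\rightarrow y)=x\wedge y$; (C4) $x\rightarrow y\le(z\wedge x)\rightarrow(z\wedge y)$; (C5) $x\rightarrow y\le(z\vee x)\rightarrow(z\vee y)$. A connexive Boolean algebra is a connexive Heyting algebra satisfying additionally $\neg\neg x=x$ for all $x$. -}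

module Defs where

open import Level using (Level; _⊔_)
open import Data.Product using (Σ; ∃; _,_; proj₁; _×_)
open import Relation.Binary.Core using (Rel)
open import Algebra.Core using (Op₂)
import Algebra.Definitions as AD
import Algebra.Lattice.Structures as LS
import Relation.Binary.PropositionalEquality as P

module _ {a ℓ : Level} {A : Set a} (_≈_ : Rel A ℓ) where

  record IsConnexiveHeytingAlgebra
      (_∧_ _∨_ _⇒_ : Op₂ A) (0# 1# : A) : Set (a ⊔ ℓ) where
    field
      isDistributiveLattice : LS.IsDistributiveLattice _≈_ _∨_ _∧_
      ∧-identity : AD.Identity _≈_ 1# _∧_
      ∨-identity : AD.Identity _≈_ 0# _∨_
      ⇒-cong     : AD.Congruent₂ _≈_ _⇒_
    ¬_ : A → A
    ¬ x = x ⇒ 0#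
    _≤_ : A → A → Set ℓ
    x ≤ y = (x ∧ y) ≈ x
    field
      C1 : ∀ x y z → ((x ⇒ y) ⇒ ((y ⇒ z) ⇒ (x ⇒ z))) ≈ 1#
      C2 : ∀ x y → ((x ⇒ y) ⇒ (¬ (x ⇒ (¬ y)))) ≈ 1#
      C3 : ∀ x y → (x ∧ (x ⇒ y)) ≈ (x ∧ y)
      C4 : ∀ x y z → (x ⇒ y) ≤ ((z ∧ x) ⇒ (z ∧ y))
      C5 : ∀ x y z → (x ⇒ y) ≤ ((z ∨ x) ⇒ (z ∨ y))
    open LS.IsDistributiveLattice isDistributiveLattice public

  record IsConnexiveBooleanAlgebra
      (_∧_ _∨_ _⇒_ : Op₂ A) (0# 1# : A) : Set (a ⊔ ℓ) where
    field
      isConnexiveHeytingAlgebra : IsConnexiveHeytingAlgebra _∧_ _∨_ _⇒_ 0# 1#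
    open IsConnexiveHeytingAlgebra isConnexiveHeytingAlgebra public
    field
      ¬¬-involutive : ∀ x → (¬ (¬ x)) ≈ x

module Bar {a ℓ : Level} {A : Set a} {_≈_ : Rel A ℓ}
           {_∧_ _∨_ _⇒_ : Op₂ A} {0# 1# : A}
           (isCHA : IsConnexiveHeytingAlgebra _≈_ _∧_ _∨_ _⇒_ 0# 1#) where

  open IsConnexiveHeytingAlgebra isCHA using (¬_; refl)

  ¬¬ : A → A
  ¬¬ x = ¬ (¬ x)

  InBar : A → Set (a ⊔ ℓ)
  InBar x = ∃ λ b → x ≈ ¬¬ b

  Ā : Set (a ⊔ ℓ)
  Ā = Σ A InBar

  _≈̄_ : Rel Ā ℓ
  x ≈̄ y = proj₁ x ≈ proj₁ y

  h : A → Ā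
  h x = ¬¬ x , x , refl

  _⋓_ : Op₂ Ā
  (x , _) ⋓ (y , _) = h (x ∨ y)

  -- Closure of Ā under ∧, ⇒, 0 and 1 (closure under ⋓ holds by construction).
  -- Given such closure proofs, the remaining operations of Ā are the
  -- restrictions of those of A.
  record Closed : Set (a ⊔ ℓ) where
    field
      ∧-closed : ∀ x y → InBar x → InBar y → InBar (x ∧ y)
      ⇒-closed : ∀ x y → InBar x → InBar y → InBar (x ⇒ y)
      0-closed : InBar 0#
      1-closed : InBar 1#

    _⋒_ : Op₂ Ā
    (x , p) ⋒ (y , q) = (x ∧ y) , ∧-closed x y p q

    _⇒̄_ : Op₂ Ā
    (x , p) ⇒̄ (y , q) = (x ⇒ y) , ⇒-closed x y p q

    0̄ : Ā
    0̄ = 0# , 0-closed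

    1̄ : Ā
    1̄ = 1# , 1-closed

module Submission where

-- The negation ¬ x = x ⇒ 0 of a connexive Heyting algebra is a pseudocomplement
-- (y ≤ ¬ x iff x ∧ y = 0), so, as in any pseudocomplemented distributive lattice,
-- ¬¬ preserves ∧, 0 and 1, and its image is a Boolean lattice under ∧ and
-- ¬¬(x ∨ y).  The connexive content is that ¬¬ also commutes with ⇒.  On regular
-- elements (¬¬ x = x) one has x ⇒ 1 = x, so C1 with z = 1 makes implication
-- symmetric there; the same argument under ¬¬ shows ¬¬(x ⇒ y) ≤ ¬¬(y ⇒ x) for
-- all x, y.  Routing x ⇒ y through x ⇒ (x ∧ y) and (x ∧ y) ⇒ y then gives both
-- inequalities of ¬¬(x ⇒ y) = ¬¬x ⇒ ¬¬y.

open import Defs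
open import Level using (Level)
open import Data.Product using (Σ; ∃; _×_; _,_; proj₁; proj₂)
open import Relation.Binary.Core using (Rel)
open import Algebra.Core using (Op₁; Op₂)
open import Algebra.Definitions using (Identity)
open import Algebra.Lattice.Bundles using (Lattice)
open import Algebra.Lattice.Structures using (IsLattice; IsDistributiveLattice)
import Algebra.Lattice.Structures.Biased as Biased
import Algebra.Lattice.Properties.Lattice as LatticeProperties
import Relation.Binary.Lattice.Bundles as OrderTheoretic
import Relation.Binary.Lattice.Properties.MeetSemilattice as MeetSemilatticeProperties
import Relation.Binary.Lattice.Properties.JoinSemilattice as JoinSemilatticeProperties

module LatticeOrder
    {c ℓ} {A : Set c} {_≈_ : Rel A ℓ} {_∨_ _∧_ : Op₂ A} {0# 1# : A}
    (isLattice : IsLattice _≈_ _∨_ _∧_)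
    (∧-identity : Identity _≈_ 1# _∧_) (∨-identity : Identity _≈_ 0# _∨_) where

  open IsLattice isLattice using (sym; trans; ∧-congˡ; ∧-absorbs-∨)

  private
    lattice : Lattice c ℓ
    lattice = record { isLattice = isLattice }

  open LatticeProperties lattice using (∨-∧-orderTheoreticLattice)
  open OrderTheoretic.Lattice ∨-∧-orderTheoreticLattice public
    using (setoid; poset; _≤_; x∧y≤x; x∧y≤y; ∧-greatest; x≤x∨y; y≤x∨y)
    renaming (refl to ≤-refl; reflexive to ≤-reflexive; trans to ≤-trans; antisym to ≤-antisym)
  open OrderTheoretic.Lattice ∨-∧-orderTheoreticLattice
    using (meetSemilattice; joinSemilattice)
  open MeetSemilatticeProperties meetSemilattice public using (∧-monotonic)
  open JoinSemilatticeProperties joinSemilattice public using (x≤y⇒x∨y≈y)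

  x≤1 : ∀ {x} → x ≤ 1#
  x≤1 {x} = sym (proj₂ ∧-identity x)

  0≤x : ∀ {x} → 0# ≤ x
  0≤x {x} = sym (trans (∧-congˡ (sym (proj₁ ∨-identity x))) (∧-absorbs-∨ 0# x))

  x≤0⇒x≈0 : ∀ {x} → x ≤ 0# → x ≈ 0#
  x≤0⇒x≈0 x≤0 = ≤-antisym x≤0 0≤x

module PseudocomplementedLattice
    {c ℓ} {A : Set c} {_≈_ : Rel A ℓ} {_∨_ _∧_ : Op₂ A} {0# 1# : A}
    (isDistributiveLattice : IsDistributiveLattice _≈_ _∨_ _∧_)
    (∧-identity : Identity _≈_ 1# _∧_) (∨-identity : Identity _≈_ 0# _∨_) where

  open IsDistributiveLattice isDistributiveLattice
  open LatticeOrder isLattice ∧-identity ∨-identity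

  module Pseudocomplement
      (¬_ : Op₁ A)
      (x∧¬x≈0 : ∀ x → (x ∧ (¬ x)) ≈ 0#)
      (∧≈0⇒≤¬ : ∀ {x y} → (x ∧ y) ≈ 0# → y ≤ (¬ x)) where

    ≤∧≤¬⇒≈0 : ∀ {x y} → x ≤ y → x ≤ ¬ y → x ≈ 0#
    ≤∧≤¬⇒≈0 {y = y} x≤y x≤¬y =
      x≤0⇒x≈0 (≤-trans (∧-greatest x≤y x≤¬y) (≤-reflexive (x∧¬x≈0 y)))

    ¬-antimono : ∀ {x y} → x ≤ y → ¬ y ≤ ¬ x
    ¬-antimono {x} {y} x≤y =
      ∧≈0⇒≤¬ (≤∧≤¬⇒≈0 (≤-trans (x∧y≤x x (¬ y)) x≤y) (x∧y≤y x (¬ y)))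

    ¬-cong : ∀ {x y} → x ≈ y → (¬ x) ≈ (¬ y)
    ¬-cong x≈y = ≤-antisym (¬-antimono (≤-reflexive (sym x≈y))) (¬-antimono (≤-reflexive x≈y))

    ¬¬-cong : ∀ {x y} → x ≈ y → (¬ ¬ x) ≈ (¬ ¬ y)
    ¬¬-cong x≈y = ¬-cong (¬-cong x≈y)

    ¬¬-mono : ∀ {x y} → x ≤ y → ¬ ¬ x ≤ ¬ ¬ y
    ¬¬-mono x≤y = ¬-antimono (¬-antimono x≤y)

    x≤¬¬x : ∀ {x} → x ≤ ¬ ¬ x
    x≤¬¬x {x} = ∧≈0⇒≤¬ (trans (∧-comm (¬ x) x) (x∧¬x≈0 x))

    ¬¬¬x≈¬x : ∀ {x} → (¬ ¬ ¬ x) ≈ (¬ x)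
    ¬¬¬x≈¬x = ≤-antisym (¬-antimono x≤¬¬x) x≤¬¬x

    ¬¬-idem : ∀ {x} → (¬ ¬ ¬ ¬ x) ≈ (¬ ¬ x)
    ¬¬-idem = ¬-cong ¬¬¬x≈¬x

    x≈¬¬y⇒¬¬x≈x : ∀ {x y} → x ≈ (¬ ¬ y) → (¬ ¬ x) ≈ x
    x≈¬¬y⇒¬¬x≈x x≈¬¬y = trans (¬¬-cong x≈¬¬y) (trans ¬¬-idem (sym x≈¬¬y))

    ¬0≈1 : (¬ 0#) ≈ 1#
    ¬0≈1 = ≤-antisym x≤1 (∧≈0⇒≤¬ (proj₂ ∧-identity 0#))

    ¬1≈0 : (¬ 1#) ≈ 0#
    ¬1≈0 = trans (sym (proj₁ ∧-identity (¬ 1#))) (x∧¬x≈0 1#)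

    ¬¬0≈0 : (¬ ¬ 0#) ≈ 0#
    ¬¬0≈0 = trans (¬-cong ¬0≈1) ¬1≈0

    ¬¬1≈1 : (¬ ¬ 1#) ≈ 1#
    ¬¬1≈1 = trans (¬-cong ¬1≈0) ¬0≈1

    ¬¬-distrib-∧ : ∀ x y → (¬ ¬ (x ∧ y)) ≈ ((¬ ¬ x) ∧ (¬ ¬ y))
    ¬¬-distrib-∧ x y =
      ≤-antisym (∧-greatest (¬¬-mono (x∧y≤x x y)) (¬¬-mono (x∧y≤y x y))) (∧≈0⇒≤¬ n∧¬¬x∧¬¬y≈0)
      where
      n = ¬ (x ∧ y)
      n∧x≤¬y : (n ∧ x) ≤ ¬ y
      n∧x≤¬y = ∧≈0⇒≤¬ (≤∧≤¬⇒≈0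
        (∧-greatest (≤-trans (x∧y≤y y (n ∧ x)) (x∧y≤y n x)) (x∧y≤x y (n ∧ x)))
        (≤-trans (x∧y≤y y (n ∧ x)) (x∧y≤x n x)))
      n∧¬¬y≤¬x : (n ∧ (¬ ¬ y)) ≤ ¬ x
      n∧¬¬y≤¬x = ∧≈0⇒≤¬ (≤∧≤¬⇒≈0 {y = ¬ y}
        (≤-trans (∧-greatest (≤-trans (x∧y≤y x (n ∧ (¬ ¬ y))) (x∧y≤x n (¬ ¬ y))) (x∧y≤x x (n ∧ (¬ ¬ y))))
                 n∧x≤¬y)
        (≤-trans (x∧y≤y x (n ∧ (¬ ¬ y))) (x∧y≤y n (¬ ¬ y))))
      n∧¬¬x∧¬¬y≈0 : (n ∧ ((¬ ¬ x) ∧ (¬ ¬ y))) ≈ 0#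
      n∧¬¬x∧¬¬y≈0 = ≤∧≤¬⇒≈0 {y = ¬ x}
        (≤-trans (∧-monotonic ≤-refl (x∧y≤y (¬ ¬ x) (¬ ¬ y))) n∧¬¬y≤¬x)
        (≤-trans (x∧y≤y n ((¬ ¬ x) ∧ (¬ ¬ y))) (x∧y≤x (¬ ¬ x) (¬ ¬ y)))

    ¬¬-lift-∧ : ∀ {t x y z} → (x ∧ y) ≤ z → t ≤ ¬ ¬ x → t ≤ ¬ ¬ y → t ≤ ¬ ¬ z
    ¬¬-lift-∧ {x = x} {y} x∧y≤z t≤¬¬x t≤¬¬y =
      ≤-trans (∧-greatest t≤¬¬x t≤¬¬y) (≤-trans (≤-reflexive (sym (¬¬-distrib-∧ x y))) (¬¬-mono x∧y≤z))

    de-morgan₁ : ∀ x y → (¬ (x ∨ y)) ≈ ((¬ x) ∧ (¬ y))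
    de-morgan₁ x y =
      ≤-antisym (∧-greatest (¬-antimono (x≤x∨y x y)) (¬-antimono (y≤x∨y x y))) (∧≈0⇒≤¬ [x∨y]∧[¬x∧¬y]≈0)
      where
      [x∨y]∧[¬x∧¬y]≈0 : ((x ∨ y) ∧ ((¬ x) ∧ (¬ y))) ≈ 0#
      [x∨y]∧[¬x∧¬y]≈0 = begin
        (x ∨ y) ∧ ((¬ x) ∧ (¬ y))                       ≈⟨ ∧-distribʳ-∨ ((¬ x) ∧ (¬ y)) x y ⟩
        (x ∧ ((¬ x) ∧ (¬ y))) ∨ (y ∧ ((¬ x) ∧ (¬ y)))   ≈⟨ ∨-cong x∧[¬x∧¬y]≈0 y∧[¬x∧¬y]≈0 ⟩
        0# ∨ 0#                                         ≈⟨ proj₁ ∨-identity 0# ⟩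
        0#                                              ∎
        where
        open import Relation.Binary.Reasoning.Setoid setoid
        x∧[¬x∧¬y]≈0 : (x ∧ ((¬ x) ∧ (¬ y))) ≈ 0#
        x∧[¬x∧¬y]≈0 = ≤∧≤¬⇒≈0 (x∧y≤x x _) (≤-trans (x∧y≤y x _) (x∧y≤x (¬ x) (¬ y)))
        y∧[¬x∧¬y]≈0 : (y ∧ ((¬ x) ∧ (¬ y))) ≈ 0#
        y∧[¬x∧¬y]≈0 = ≤∧≤¬⇒≈0 (x∧y≤x y _) (≤-trans (x∧y≤y y _) (x∧y≤y (¬ x) (¬ y)))

    ¬¬[¬¬x∨y]≈¬¬[x∨y] : ∀ x y → (¬ ¬ ((¬ ¬ x) ∨ y)) ≈ (¬ ¬ (x ∨ y))
    ¬¬[¬¬x∨y]≈¬¬[x∨y] x y =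
      ¬-cong (trans (de-morgan₁ (¬ ¬ x) y) (trans (∧-congʳ ¬¬¬x≈¬x) (sym (de-morgan₁ x y))))

    ¬¬[x∨¬¬y]≈¬¬[x∨y] : ∀ x y → (¬ ¬ (x ∨ (¬ ¬ y))) ≈ (¬ ¬ (x ∨ y))
    ¬¬[x∨¬¬y]≈¬¬[x∨y] x y =
      ¬-cong (trans (de-morgan₁ x (¬ ¬ y)) (trans (∧-congˡ ¬¬¬x≈¬x) (sym (de-morgan₁ x y))))

-- The implication is written _⇨_, as in the standard library's Heyting algebras,
-- so that ⇒ in lemma names keeps its usual meaning of "implies".
module ConnexiveHeytingAlgebraProperties
    {a ℓ} {A : Set a} {_≈_ : Rel A ℓ} {_∧_ _∨_ _⇨_ : Op₂ A} {0# 1# : A}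
    (isCHA : IsConnexiveHeytingAlgebra _≈_ _∧_ _∨_ _⇨_ 0# 1#) where

  open IsConnexiveHeytingAlgebra isCHA hiding (_≤_) renaming (⇒-cong to ⇨-cong)
  open LatticeOrder isLattice ∧-identity ∨-identity public

  -- The order used here is the standard library's x ≈ x ∧ y, the mirror image of
  -- the _≤_ of the axioms.
  C4-≤ : ∀ x y z → (x ⇨ y) ≤ ((z ∧ x) ⇨ (z ∧ y))
  C4-≤ x y z = sym (C4 x y z)

  C5-≤ : ∀ x y z → (x ⇨ y) ≤ ((z ∨ x) ⇨ (z ∨ y))
  C5-≤ x y z = sym (C5 x y z)

  ⇨-identityˡ : ∀ x → (1# ⇨ x) ≈ x
  ⇨-identityˡ x = begin
    1# ⇨ x          ≈⟨ proj₁ ∧-identity (1# ⇨ x) ⟨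
    1# ∧ (1# ⇨ x)   ≈⟨ C3 1# x ⟩
    1# ∧ x          ≈⟨ proj₁ ∧-identity x ⟩
    x               ∎
    where open import Relation.Binary.Reasoning.Setoid setoid

  ⇨≈1⇒≤ : ∀ {x y} → (x ⇨ y) ≈ 1# → x ≤ y
  ⇨≈1⇒≤ {x} {y} x⇨y≈1 = sym (begin
    x ∧ y          ≈⟨ C3 x y ⟨
    x ∧ (x ⇨ y)    ≈⟨ ∧-congˡ x⇨y≈1 ⟩
    x ∧ 1#         ≈⟨ proj₂ ∧-identity x ⟩
    x              ∎)
    where open import Relation.Binary.Reasoning.Setoid setoid

  ⇨-eval : ∀ {x y} → ((x ⇨ y) ∧ x) ≤ y
  ⇨-eval {x} {y} = ≤-trans (≤-reflexive (trans (∧-comm (x ⇨ y) x) (C3 x y))) (x∧y≤y x y)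

  ⇨-trans : ∀ {x y z} → ((x ⇨ y) ∧ (y ⇨ z)) ≤ (x ⇨ z)
  ⇨-trans {x} {y} {z} = ≤-trans (∧-monotonic (⇨≈1⇒≤ (C1 x y z)) ≤-refl) ⇨-eval

  ⇨-swap : ∀ {x y z} → (x ⇨ y) ≤ ((y ⇨ z) ⇨ (x ⇨ z))
  ⇨-swap {x} {y} {z} = ⇨≈1⇒≤ (C1 x y z)

  y≤x⇨x∧y : ∀ {x y} → y ≤ (x ⇨ (x ∧ y))
  y≤x⇨x∧y {x} {y} =
    ≤-trans (≤-reflexive (sym (⇨-identityˡ y)))
            (≤-trans (C4-≤ 1# y x) (≤-reflexive (⇨-cong (proj₂ ∧-identity x) refl)))

  x∧¬x≈0 : ∀ x → (x ∧ (¬ x)) ≈ 0#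
  x∧¬x≈0 x = trans (C3 x 0#) (x≤0⇒x≈0 (x∧y≤y x 0#))

  ∧≈0⇒≤¬ : ∀ {x y} → (x ∧ y) ≈ 0# → y ≤ (¬ x)
  ∧≈0⇒≤¬ x∧y≈0 = ≤-trans y≤x⇨x∧y (≤-reflexive (⇨-cong refl x∧y≈0))

  open PseudocomplementedLattice.Pseudocomplement isDistributiveLattice ∧-identity ∨-identity
    ¬_ x∧¬x≈0 ∧≈0⇒≤¬ public

  ⇨-∧-intro : ∀ {t x y} → (t ∧ x) ≤ y → t ≤ (x ⇨ (x ∧ y))
  ⇨-∧-intro {t} {x} {y} t∧x≤y = begin
    t                                  ≤⟨ y≤x⇨x∧y ⟩
    x ⇨ (x ∧ t)                        ≤⟨ C5-≤ x (x ∧ t) (x ∧ y) ⟩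
    ((x ∧ y) ∨ x) ⇨ ((x ∧ y) ∨ (x ∧ t)) ≈⟨ ⇨-cong (trans (∨-comm (x ∧ y) x) (∨-absorbs-∧ x y))
                                                 (trans (∨-comm (x ∧ y) (x ∧ t)) (x≤y⇒x∨y≈y x∧t≤x∧y)) ⟩
    x ⇨ (x ∧ y)                        ∎
    where
    open import Relation.Binary.Reasoning.PartialOrder poset
    x∧t≤x∧y : (x ∧ t) ≤ (x ∧ y)
    x∧t≤x∧y = ∧-greatest (x∧y≤x x t) (≤-trans (≤-reflexive (∧-comm x t)) t∧x≤y)

  x≤x⇨1 : ∀ {x} → x ≤ (x ⇨ 1#)
  x≤x⇨1 {x} = sym (trans (C3 x 1#) (proj₂ ∧-identity x))

  x⇨1≤¬¬x : ∀ {x} → (x ⇨ 1#) ≤ (¬ ¬ x)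
  x⇨1≤¬¬x {x} = ≤-trans x≤¬¬x (¬-antimono ¬x≤¬[x⇨1])
    where
    ¬x≤¬[x⇨1] : (¬ x) ≤ (¬ (x ⇨ 1#))
    ¬x≤¬[x⇨1] = ≤-trans (⇨≈1⇒≤ (C2 x 0#)) (≤-reflexive (¬-cong (⇨-cong refl ¬0≈1)))

  1≤x⇨[x⇨1] : ∀ {x} → 1# ≤ (x ⇨ (x ⇨ 1#))
  1≤x⇨[x⇨1] {x} = begin
    1#                                          ≈⟨ C2 1# x ⟨
    (1# ⇨ x) ⇨ (¬ (1# ⇨ (¬ x)))                 ≈⟨ ⇨-cong (⇨-identityˡ x) (¬-cong (⇨-identityˡ (¬ x))) ⟩
    x ⇨ (¬ ¬ x)                                 ≤⟨ C4-≤ x (¬ ¬ x) (x ⇨ 1#) ⟩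
    ((x ⇨ 1#) ∧ x) ⇨ ((x ⇨ 1#) ∧ (¬ ¬ x))       ≈⟨ ⇨-cong (trans (∧-comm (x ⇨ 1#) x) (sym x≤x⇨1)) (sym x⇨1≤¬¬x) ⟩
    x ⇨ (x ⇨ 1#)                                ∎
    where open import Relation.Binary.Reasoning.PartialOrder poset

  ¬¬x≈x⇒x⇨1≈x : ∀ {x} → (¬ ¬ x) ≈ x → (x ⇨ 1#) ≈ x
  ¬¬x≈x⇒x⇨1≈x ¬¬x≈x = ≤-antisym (≤-trans x⇨1≤¬¬x (≤-reflexive ¬¬x≈x)) x≤x⇨1

  regular-⇨-comm : ∀ {x y} → (¬ ¬ x) ≈ x → (¬ ¬ y) ≈ y → (x ⇨ y) ≤ (y ⇨ x)
  regular-⇨-comm ¬¬x≈x ¬¬y≈y =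
    ≤-trans ⇨-swap (≤-reflexive (⇨-cong (¬¬x≈x⇒x⇨1≈x ¬¬y≈y) (¬¬x≈x⇒x⇨1≈x ¬¬x≈x)))

  regular-⇨-intro : ∀ {t x y} → (¬ ¬ x) ≈ x → (¬ ¬ y) ≈ y →
                    (t ∧ x) ≤ y → (t ∧ y) ≤ x → t ≤ (x ⇨ y)
  regular-⇨-intro {t} {x} {y} ¬¬x≈x ¬¬y≈y t∧x≤y t∧y≤x =
    ≤-trans (∧-greatest (⇨-∧-intro t∧x≤y) t≤[x∧y]⇨y) ⇨-trans
    where
    t≤[x∧y]⇨y : t ≤ ((x ∧ y) ⇨ y)
    t≤[x∧y]⇨y = begin
      t                ≤⟨ ⇨-∧-intro t∧y≤x ⟩
      y ⇨ (y ∧ x)      ≈⟨ ⇨-cong refl (∧-comm y x) ⟩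
      y ⇨ (x ∧ y)      ≤⟨ regular-⇨-comm ¬¬y≈y (trans (¬¬-distrib-∧ x y) (∧-cong ¬¬x≈x ¬¬y≈y)) ⟩
      (x ∧ y) ⇨ y      ∎
      where open import Relation.Binary.Reasoning.PartialOrder poset

  x≤0⇨¬x : ∀ {x} → x ≤ (0# ⇨ (¬ x))
  x≤0⇨¬x {x} = ≤-trans x≤x⇨1 (≤-trans ⇨-swap (≤-reflexive (⇨-cong ¬1≈0 refl)))

  x⇨y∧y≤¬¬x : ∀ {x y} → ((x ⇨ y) ∧ y) ≤ (¬ ¬ x)
  x⇨y∧y≤¬¬x {x} {y} = ∧≈0⇒≤¬ (≤∧≤¬⇒≈0 {y = 0# ⇨ (¬ w)} (≤-trans r≤w x≤0⇨¬x) r≤¬[0⇨¬w])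
    where
    w = (¬ x) ∧ y
    r = (¬ x) ∧ ((x ⇨ y) ∧ y)
    r≤w : r ≤ w
    r≤w = ∧-monotonic ≤-refl (x∧y≤y (x ⇨ y) y)
    r≤¬[0⇨¬w] : r ≤ (¬ (0# ⇨ (¬ w)))
    r≤¬[0⇨¬w] = begin
      r               ≤⟨ ≤-trans (x∧y≤y (¬ x) _) (x∧y≤x (x ⇨ y) y) ⟩
      x ⇨ y           ≤⟨ C4-≤ x y (¬ x) ⟩
      ((¬ x) ∧ x) ⇨ w ≈⟨ ⇨-cong (trans (∧-comm (¬ x) x) (x∧¬x≈0 x)) refl ⟩
      0# ⇨ w          ≤⟨ ⇨≈1⇒≤ (C2 0# w) ⟩
      ¬ (0# ⇨ (¬ w))  ∎
      where open import Relation.Binary.Reasoning.PartialOrder poset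

  ¬¬-⇨-∧-intro : ∀ {t x y} → (t ∧ (¬ ¬ x)) ≤ (¬ ¬ y) → t ≤ (¬ ¬ (x ⇨ (x ∧ y)))
  ¬¬-⇨-∧-intro {t} {x} {y} t∧¬¬x≤¬¬y = ∧≈0⇒≤¬ (≤∧≤¬⇒≈0 {y = ¬ y}
    (≤-trans (x∧y≤x (¬ e) t) ¬e≤¬y)
    (≤-trans (∧-greatest (x∧y≤y (¬ e) t) (≤-trans (x∧y≤x (¬ e) t) ¬e≤¬¬x)) t∧¬¬x≤¬¬y))
    where
    e = x ⇨ (x ∧ y)
    ¬e≤¬y : (¬ e) ≤ (¬ y)
    ¬e≤¬y = ¬-antimono y≤x⇨x∧y
    ¬e≤¬¬x : (¬ e) ≤ (¬ ¬ x)
    ¬e≤¬¬x = ¬-antimono (⇨-∧-intro (≤-trans (≤-reflexive (trans (∧-comm (¬ x) x) (x∧¬x≈0 x))) 0≤x))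

  ¬¬-⇨-trans : ∀ {t x y z} → t ≤ (¬ ¬ (x ⇨ y)) → t ≤ (¬ ¬ (y ⇨ z)) → t ≤ (¬ ¬ (x ⇨ z))
  ¬¬-⇨-trans = ¬¬-lift-∧ ⇨-trans

  1≤¬¬[[x⇨1]⇨x] : ∀ {x} → 1# ≤ (¬ ¬ ((x ⇨ 1#) ⇨ x))
  1≤¬¬[[x⇨1]⇨x] {x} =
    ≤-trans (¬¬-⇨-∧-intro 1∧¬¬[x⇨1]≤¬¬x)
            (¬¬-mono (≤-reflexive (⇨-cong refl (trans (∧-comm (x ⇨ 1#) x) (sym x≤x⇨1)))))
    where
    1∧¬¬[x⇨1]≤¬¬x : (1# ∧ (¬ ¬ (x ⇨ 1#))) ≤ (¬ ¬ x)
    1∧¬¬[x⇨1]≤¬¬x = ≤-trans (x∧y≤y 1# _) (≤-trans (¬¬-mono x⇨1≤¬¬x) (≤-reflexive ¬¬-idem))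

  ¬¬[x⇨y]≤¬¬[y⇨x] : ∀ {x y} → (¬ ¬ (x ⇨ y)) ≤ (¬ ¬ (y ⇨ x))
  ¬¬[x⇨y]≤¬¬[y⇨x] = ¬¬-⇨-trans (¬¬-⇨-trans (≤-trans x≤1 (≤-trans 1≤x⇨[x⇨1] x≤¬¬x)) (¬¬-mono ⇨-swap))
                                (≤-trans x≤1 1≤¬¬[[x⇨1]⇨x])

  ¬¬-⇨-intro : ∀ {t x y} → (t ∧ (¬ ¬ x)) ≤ (¬ ¬ y) → (t ∧ (¬ ¬ y)) ≤ (¬ ¬ x) → t ≤ (¬ ¬ (x ⇨ y))
  ¬¬-⇨-intro {x = x} {y} t∧¬¬x≤¬¬y t∧¬¬y≤¬¬x = ¬¬-⇨-trans (¬¬-⇨-∧-intro t∧¬¬x≤¬¬y)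
    (≤-trans (¬¬-⇨-∧-intro t∧¬¬y≤¬¬x)
             (≤-trans (≤-reflexive (¬¬-cong (⇨-cong refl (∧-comm y x)))) ¬¬[x⇨y]≤¬¬[y⇨x]))

  ¬¬-distrib-⇨ : ∀ x y → (¬ ¬ (x ⇨ y)) ≈ ((¬ ¬ x) ⇨ (¬ ¬ y))
  ¬¬-distrib-⇨ x y = ≤-antisym
    (regular-⇨-intro ¬¬-idem ¬¬-idem
       (¬¬-lift-∧ ⇨-eval (x∧y≤x _ _) (x∧y≤y _ _))
       (≤-trans (¬¬-lift-∧ x⇨y∧y≤¬¬x (x∧y≤x _ _) (x∧y≤y _ _)) (≤-reflexive ¬¬-idem)))
    (¬¬-⇨-intro ⇨-eval (≤-trans x⇨y∧y≤¬¬x (≤-reflexive ¬¬-idem)))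

module DoubleNegationImage
    {a ℓ} {A : Set a} {_≈_ : Rel A ℓ} {_∧_ _∨_ _⇨_ : Op₂ A} {0# 1# : A}
    (isCHA : IsConnexiveHeytingAlgebra _≈_ _∧_ _∨_ _⇨_ 0# 1#) where

  open IsConnexiveHeytingAlgebra isCHA hiding (_≤_) renaming (⇒-cong to ⇨-cong)
  open ConnexiveHeytingAlgebraProperties isCHA
  open Bar isCHA

  InBar-∧ : ∀ x y → InBar x → InBar y → InBar (x ∧ y)
  InBar-∧ _ _ (b , x≈¬¬b) (c , y≈¬¬c) = b ∧ c , trans (∧-cong x≈¬¬b y≈¬¬c) (sym (¬¬-distrib-∧ b c))

  InBar-⇨ : ∀ x y → InBar x → InBar y → InBar (x ⇨ y)
  InBar-⇨ _ _ (b , x≈¬¬b) (c , y≈¬¬c) = b ⇨ c , trans (⇨-cong x≈¬¬b y≈¬¬c) (sym (¬¬-distrib-⇨ b c))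

  closed : Closed
  closed = record
    { ∧-closed = InBar-∧
    ; ⇒-closed = InBar-⇨
    ; 0-closed = 0# , sym ¬¬0≈0
    ; 1-closed = 1# , sym ¬¬1≈1
    }

  open Closed closed

  h-surjective : ∀ (y : Ā) → ∃ λ x → h x ≈̄ y
  h-surjective (_ , x , y≈¬¬x) = x , sym y≈¬¬x

  ¬¬-fixes-Ā : (x : Ā) → (¬ ¬ proj₁ x) ≈ proj₁ x
  ¬¬-fixes-Ā (_ , _ , x≈¬¬y) = x≈¬¬y⇒¬¬x≈x x≈¬¬y

  Ā-isLattice : IsLattice _≈̄_ _⋓_ _⋒_
  Ā-isLattice = record
    { isEquivalence = record { refl = refl ; sym = sym ; trans = trans }
    ; ∨-comm        = λ _ _ → ¬¬-cong (∨-comm _ _)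
    ; ∨-assoc       = λ x y z → begin
        ¬ ¬ ((¬ ¬ (proj₁ x ∨ proj₁ y)) ∨ proj₁ z) ≈⟨ ¬¬[¬¬x∨y]≈¬¬[x∨y] _ _ ⟩
        ¬ ¬ ((proj₁ x ∨ proj₁ y) ∨ proj₁ z)       ≈⟨ ¬¬-cong (∨-assoc _ _ _) ⟩
        ¬ ¬ (proj₁ x ∨ (proj₁ y ∨ proj₁ z))       ≈⟨ ¬¬[x∨¬¬y]≈¬¬[x∨y] _ _ ⟨
        ¬ ¬ (proj₁ x ∨ (¬ ¬ (proj₁ y ∨ proj₁ z))) ∎
    ; ∨-cong        = λ x≈y u≈v → ¬¬-cong (∨-cong x≈y u≈v)
    ; ∧-comm        = λ _ _ → ∧-comm _ _
    ; ∧-assoc       = λ _ _ _ → ∧-assoc _ _ _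
    ; ∧-cong        = ∧-cong
    ; absorptive    = (λ x y → trans (¬¬-cong (∨-absorbs-∧ _ _)) (¬¬-fixes-Ā x))
                    , (λ _ _ → sym (≤-trans (x≤x∨y _ _) x≤¬¬x))
    }
    where open import Relation.Binary.Reasoning.Setoid setoid

  isConnexiveBooleanAlgebra : IsConnexiveBooleanAlgebra _≈̄_ _⋒_ _⋓_ _⇒̄_ 0̄ 1̄
  isConnexiveBooleanAlgebra = record
    { isConnexiveHeytingAlgebra = record
      { isDistributiveLattice = Biased.isDistributiveLatticeʳʲᵐ (record
          { isLattice    = Ā-isLattice
          ; ∨-distribʳ-∧ = λ _ _ _ → trans (¬¬-cong (∨-distribʳ-∧ _ _ _)) (¬¬-distrib-∧ _ _)
          })
      ; ∧-identity = (λ _ → proj₁ ∧-identity _) , (λ _ → proj₂ ∧-identity _)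
      ; ∨-identity = (λ x → trans (¬¬-cong (proj₁ ∨-identity _)) (¬¬-fixes-Ā x))
                   , (λ x → trans (¬¬-cong (proj₂ ∨-identity _)) (¬¬-fixes-Ā x))
      ; ⇒-cong     = ⇨-cong
      ; C1         = λ _ _ _ → C1 _ _ _
      ; C2         = λ _ _ → C2 _ _
      ; C3         = λ _ _ → C3 _ _
      ; C4         = λ _ _ _ → C4 _ _ _
      ; C5         = λ x y z → sym (≤-trans (C5-≤ _ _ (proj₁ z))
                                            (≤-trans x≤¬¬x (≤-reflexive (¬¬-distrib-⇨ _ _))))
      }
    ; ¬¬-involutive = ¬¬-fixes-Ā
    }

theorem3p19 : {a ℓ : Level} {A : Set a} {_≈_ : Rel A ℓ}
    {_∧_ _∨_ _⇒_ : Op₂ A} {0# 1# : A} →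
    (isCHA : IsConnexiveHeytingAlgebra _≈_ _∧_ _∨_ _⇒_ 0# 1#) →
    let open Bar isCHA in
    Σ Closed λ cl →
      let open Closed cl in
      IsConnexiveBooleanAlgebra _≈̄_ _⋒_ _⋓_ _⇒̄_ 0̄ 1̄
      × (∀ x y → x ≈ y → h x ≈̄ h y)
      × (∀ (y : Ā) → ∃ λ x → h x ≈̄ y)
      × (∀ x y → h (x ∧ y) ≈̄ (h x ⋒ h y))
      × (∀ x y → h (x ⇒ y) ≈̄ (h x ⇒̄ h y))
      × (h 0# ≈̄ 0̄)
      × (h 1# ≈̄ 1̄)
theorem3p19 isCHA =
    closed
  , isConnexiveBooleanAlgebra
  , (λ _ _ → ¬¬-cong)
  , h-surjective
  , ¬¬-distrib-∧
  , ¬¬-distrib-⇨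
  , ¬¬0≈0
  , ¬¬1≈1
  where
  open ConnexiveHeytingAlgebraProperties isCHA
  open DoubleNegationImage isCHA
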